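{- Let $G$ be a $(d,k)$-digraph with repeat permutation $r$, let $\alpha>1$ be an integer, and let $H_\alpha$ be the subdigraph of $G$ induced by the vertices $w$ for which there is an integer $t\geq0$ with $\mathrm{ord}_r(w)\mid 2^t\alpha$. Let $v\in V(H_\alpha)$ with out-neighbours $N^+(v)=\{v_1,\ldots,v_d\}$, and for $1\leq j\leq d$ let $T(v_j)$ be the set of vertices $w$ of $G$ such that some shortest walk from $v$ to $w$ passes through $v_j$. If $(z,v)$ is an arc of $G$ with $z\in T(v_j)$ for some $1\leq j\leq d$, then $v_j\in V(H_\alpha)$ if and only if $z\in V(H_\alpha)$.
   Context: A $(d,k)$-digraph (almost Moore digraph) is a finite digraph, diregular of degree $d>1$ (every vertex has in- and out-degree $d$), of diameter $k>1$ and order $N=d+d^2+\cdots+d^k$. Every vertex $v$ has a unique vertex $r(v)$ (its repeat) such that there are exactly two walks of length $\leq k$ from $v$ to $r(v)$, at least one of them of length $k$; $r$ is a permutation of $V(G)$ and an automorphism of $G$. $\mathrm{ord}_r(v)$ is the least $t\geq1$ with $r^t(v)=v$. -}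

module Defs where

open import Data.Nat using (ℕ; zero; suc; _+_; _*_; _^_; _≤_; _<_)
open import Data.Nat.Divisibility using (_∣_)
open import Data.Bool using (Bool; true; false; if_then_else_)
open import Data.Fin using (Fin; _≟_)
open import Data.List using (List; map; allFin)
open import Data.Nat.ListAction using (sum)
open import Data.Sum using (_⊎_)
open import Data.Product using (Σ; ∃; ∃-syntax; _×_; _,_)
open import Relation.Nullary using (¬_; does)
open import Relation.Binary.PropositionalEquality using (_≡_)

-- Order of a (d,k)-digraph: d + d^2 + ... + d^k
order : ℕ → ℕ → ℕ
order d zero    = 0
order d (suc k) = order d k + d ^ suc k

Digraph : ℕ → Set
Digraph n = Fin n → Fin n → Bool

module _ {n : ℕ} (A : Digraph n) where

  outdeg : Fin n → ℕ
  outdeg v = sum (map (λ u → if A v u then 1 else 0) (allFin n))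

  indeg : Fin n → ℕ
  indeg v = sum (map (λ u → if A u v then 1 else 0) (allFin n))

  Diregular : ℕ → Set
  Diregular d = ∀ v → outdeg v ≡ d × indeg v ≡ d

  data Walk : Fin n → Fin n → ℕ → Set where
    here : ∀ {v} → Walk v v 0
    step : ∀ {u x w ℓ} → A u x ≡ true → Walk x w ℓ → Walk u w (suc ℓ)

  Visits : ∀ {u w ℓ} → Walk u w ℓ → Fin n → Set
  Visits {u} here x = u ≡ x
  Visits {u} (step _ p) x = u ≡ x ⊎ Visits p x

  nWalks : ℕ → Fin n → Fin n → ℕ
  nWalks zero    u w = if does (u ≟ w) then 1 else 0
  nWalks (suc ℓ) u w = sum (map (λ x → if A u x then nWalks ℓ x w else 0) (allFin n))

  nWalks≤ : ℕ → Fin n → Fin n → ℕ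
  nWalks≤ zero    u w = nWalks zero u w
  nWalks≤ (suc k) u w = nWalks≤ k u w + nWalks (suc k) u w

  Diameter : ℕ → Set
  Diameter k = (∀ u w → ∃[ ℓ ] (ℓ ≤ k × Walk u w ℓ))
             × (∃[ u ] ∃[ w ] (∀ ℓ → ℓ < k → ¬ Walk u w ℓ))

  Shortest : ∀ {u w ℓ} → Walk u w ℓ → Set
  Shortest {u} {w} {ℓ} _ = ∀ ℓ' → ℓ' < ℓ → ¬ Walk u w ℓ'

  InT : Fin n → Fin n → Fin n → Set
  InT v x w = ∃[ ℓ ] Σ (Walk v w ℓ) (λ p → Shortest p × Visits p x)

IsDKDigraph : (d k : ℕ) → Digraph (order d k) → Set
IsDKDigraph d k A = 1 < d × 1 < k × Diregular A d × Diameter A k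

IsRepeat : {n : ℕ} → Digraph n → ℕ → (Fin n → Fin n) → Set
IsRepeat A k r = ∀ v w → (nWalks≤ A k v w ≡ 2 → w ≡ r v) × (w ≡ r v → nWalks≤ A k v w ≡ 2)

iter : {X : Set} → (X → X) → ℕ → X → X
iter f zero    x = x
iter f (suc t) x = f (iter f t x)

IsOrd : {X : Set} → (X → X) → X → ℕ → Set
IsOrd r v o = 1 ≤ o × iter r o v ≡ v × (∀ s → 1 ≤ s → s < o → ¬ iter r s v ≡ v)

InH : {X : Set} → (X → X) → ℕ → X → Set
InH r α w = ∃[ t ] ∃[ o ] (IsOrd r w o × o ∣ 2 ^ t * α)

-- The number M u w of walks u → w of length at most k is 1 + [r u = w]: every pair is joined
-- (diameter k) and the row sums are N + 1 (d-regularity).  The column sums are N + 1 as well,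
-- so r is injective, and A·M = M·A (both count walks of lengths 1 … k + 1) makes r preserve arcs.
-- If a shortest walk v → z passes through vj, the walk vj → z has length < k, so with the arc
-- z → v it shows that z is one of the at most two vertices y with y → v and a walk vj → y of
-- length < k (each contributes to M vj v ≤ 2); symmetrically vj is one of at most two vertices y
-- with v → y and a walk y → z of length < k.  A power r ^ (2 ^ t * α) fixing v and the other
-- endpoint permutes such a set, so its square fixes the unknown vertex.

module Submission where

open import Defs
open import Data.Bool using (Bool; true; false; if_then_else_)
open import Data.Empty using (⊥-elim)
open import Data.Fin using (Fin; zero; suc; _≟_; punchIn; punchOut)
open import Data.Fin.Properties using (punchIn-punchOut; punchOut-injective)
open import Data.List using (map; tabulate; allFin)
open import Data.List.Properties using (map-tabulate)
open import Data.Nat using (ℕ; zero; suc; pred; _+_; _*_; _^_; _%_; _/_; _≤_; _<_; _≤?_; z≤n; s≤s; >-nonZero)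
open import Data.Nat.Divisibility using (_∣_; divides; m%n≡0⇒n∣m)
open import Data.Nat.DivMod using (m≡m%n+[m/n]*n; m%n<n)
open import Data.Nat.Induction using (<-rec)
open import Data.Nat.ListAction as ListAction using ()
open import Data.Nat.Properties hiding (_≟_)
open import Algebra.Properties.Semiring.Sum +-*-semiring
  using (sum-syntax; sum-cong-≗; sum-remove; sum-replicate-zero; ∑-distrib-+; ∑-comm; *-distribʳ-sum)
open import Data.Product using (∃; ∃-syntax; _×_; _,_; proj₁; proj₂)
open import Data.Sum using (_⊎_; inj₁; inj₂)
open import Function using (id; _∘_)
open import Function.Bundles using (_⇔_; mk⇔; Equivalence)
open import Function.Definitions using (Injective)
open import Relation.Binary.Definitions using (DecidableEquality)
open import Relation.Binary.PropositionalEquality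
open import Relation.Nullary using (does; yes; no)
open import Relation.Nullary.Decidable using (_×-dec_)

infixr 7 _⊙_

_⊙_ : Bool → ℕ → ℕ
b ⊙ m = if b then m else 0

⊙-distribˡ-+ : ∀ b m n → b ⊙ (m + n) ≡ b ⊙ m + b ⊙ n
⊙-distribˡ-+ true  m n = refl
⊙-distribˡ-+ false m n = refl

⊙-comm : ∀ b c m → b ⊙ c ⊙ m ≡ c ⊙ b ⊙ m
⊙-comm true  c     m = refl
⊙-comm false true  m = refl
⊙-comm false false m = refl

⊙≗* : ∀ b m → b ⊙ m ≡ (b ⊙ 1) * m
⊙≗* true  m = sym (+-identityʳ m)
⊙≗* false m = refl

1≤⊙⇒true : ∀ {b m} → 1 ≤ b ⊙ m → b ≡ true
1≤⊙⇒true {true} _ = refl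

δ : ∀ {n} → Fin n → Fin n → ℕ
δ a b = does (a ≟ b) ⊙ 1

δ-refl : ∀ {n} (a : Fin n) → δ a a ≡ 1
δ-refl a with a ≟ a
... | yes _  = refl
... | no a≢a = ⊥-elim (a≢a refl)

∑-allFin : ∀ {n} (f : Fin n → ℕ) → ListAction.sum (map f (allFin n)) ≡ ∑[ i < n ] f i
∑-allFin f = trans (cong ListAction.sum (map-tabulate id f)) (sum-tabulate f)
  where
  sum-tabulate : ∀ {n} (f : Fin n → ℕ) → ListAction.sum (tabulate f) ≡ ∑[ i < n ] f i
  sum-tabulate {zero}  f = refl
  sum-tabulate {suc n} f = cong (f zero +_) (sum-tabulate (f ∘ suc))

∑-⊙ : ∀ {n} b (f : Fin n → ℕ) → ∑[ i < n ] (b ⊙ f i) ≡ b ⊙ ∑[ i < n ] f i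
∑-⊙ {n} true  f = refl
∑-⊙ {n} false f = sum-replicate-zero n

∑-⊙-const : ∀ {n} (b : Fin n → Bool) c → ∑[ i < n ] (b i ⊙ c) ≡ ∑[ i < n ] (b i ⊙ 1) * c
∑-⊙-const {n} b c = trans (sum-cong-≗ (λ i → ⊙≗* (b i) c)) (sym (*-distribʳ-sum c (λ i → b i ⊙ 1)))

∑-⊙-suc : ∀ {n} (b : Fin n → Bool) (g : Fin n → ℕ) →
          ∑[ i < n ] (b i ⊙ suc (g i)) ≡ ∑[ i < n ] (b i ⊙ 1) + ∑[ i < n ] (b i ⊙ g i)
∑-⊙-suc b g = trans (sum-cong-≗ (λ i → ⊙-distribˡ-+ (b i) 1 (g i))) (∑-distrib-+ (λ i → b i ⊙ 1) (λ i → b i ⊙ g i))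

∑-suc : ∀ {n} (g : Fin n → ℕ) → ∑[ i < n ] suc (g i) ≡ n + ∑[ i < n ] g i
∑-suc {zero}  g = refl
∑-suc {suc n} g = cong suc (begin
  g zero + ∑[ i < n ] suc (g (suc i))   ≡⟨ cong (g zero +_) (∑-suc (g ∘ suc)) ⟩
  g zero + (n + ∑[ i < n ] g (suc i))   ≡⟨ +-comm (g zero) _ ⟩
  (n + ∑[ i < n ] g (suc i)) + g zero   ≡⟨ +-assoc n _ _ ⟩
  n + (∑[ i < n ] g (suc i) + g zero)   ≡⟨ cong (n +_) (+-comm _ (g zero)) ⟩
  n + (g zero + ∑[ i < n ] g (suc i))   ∎)
  where open ≡-Reasoning

∑-sift : ∀ {n} (x : Fin n) (g : Fin n → ℕ) → ∑[ u < n ] (does (x ≟ u) ⊙ g u) ≡ g x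
∑-sift {suc n} zero    g = trans (cong (g zero +_) (sum-replicate-zero n)) (+-identityʳ _)
∑-sift {suc n} (suc x) g = ∑-sift x (g ∘ suc)

∑-sift′ : ∀ {n} (x : Fin n) (g : Fin n → ℕ) → ∑[ u < n ] (does (u ≟ x) ⊙ g u) ≡ g x
∑-sift′ {suc n} zero    g = trans (cong (g zero +_) (sum-replicate-zero n)) (+-identityʳ _)
∑-sift′ {suc n} (suc x) g = ∑-sift′ x (g ∘ suc)

≤-∑ : ∀ {n} (f : Fin n → ℕ) i → f i ≤ ∑[ j < n ] f j
≤-∑ {suc n} f i = subst (f i ≤_) (sym (sum-remove {i = i} f)) (m≤m+n _ _)

pair-≤-∑ : ∀ {n} (f : Fin n → ℕ) {i j} → i ≢ j → f i + f j ≤ ∑[ k < n ] f k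
pair-≤-∑ {suc n} f {i} {j} i≢j = begin
  f i + f j                              ≡⟨ cong (λ k → f i + f k) (punchIn-punchOut i≢j) ⟨
  f i + f (punchIn i (punchOut i≢j))     ≤⟨ +-monoʳ-≤ (f i) (≤-∑ (f ∘ punchIn i) _) ⟩
  f i + ∑[ k < n ] f (punchIn i k)       ≡⟨ sum-remove f ⟨
  ∑[ k < suc n ] f k                     ∎
  where open ≤-Reasoning

triple-≤-∑ : ∀ {n} (f : Fin n → ℕ) {i j l} → i ≢ j → i ≢ l → j ≢ l →
             f i + (f j + f l) ≤ ∑[ k < n ] f k
triple-≤-∑ {suc n} f {i} {j} {l} i≢j i≢l j≢l = begin
  f i + (f j + f l)
    ≡⟨ cong₂ (λ a b → f i + (f a + f b)) (punchIn-punchOut i≢j) (punchIn-punchOut i≢l) ⟨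
  f i + (f (punchIn i (punchOut i≢j)) + f (punchIn i (punchOut i≢l)))
    ≤⟨ +-monoʳ-≤ (f i) (pair-≤-∑ (f ∘ punchIn i) (j≢l ∘ punchOut-injective i≢j i≢l)) ⟩
  f i + ∑[ k < n ] f (punchIn i k)
    ≡⟨ sum-remove f ⟨
  ∑[ k < suc n ] f k
    ∎
  where open ≤-Reasoning

∑-excess : ∀ {n e} (f : Fin n → ℕ) → (∀ i → 1 ≤ f i) → ∑[ i < n ] f i ≡ n + e → ∀ i → f i ≤ suc e
∑-excess {n} {e} f 1≤f ∑f≡n+e i = subst (_≤ suc e) (suc-g≡f i) (s≤s (subst (g i ≤_) ∑g≡e (≤-∑ g i)))
  where
  g : Fin n → ℕ
  g i = pred (f i)
  suc-g≡f : ∀ i → suc (g i) ≡ f i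
  suc-g≡f i = suc-pred (f i) {{>-nonZero (1≤f i)}}
  ∑g≡e : ∑[ i < n ] g i ≡ e
  ∑g≡e = +-cancelˡ-≡ n _ _ (trans (sym (∑-suc g)) (trans (sum-cong-≗ suc-g≡f) ∑f≡n+e))

AtMostTwo : {X : Set} → (X → Set) → Set
AtMostTwo P = ∀ {x y z} → P x → P y → P z → x ≡ y ⊎ x ≡ z ⊎ y ≡ z

∑≤2⇒AtMostTwo : ∀ {n} {P : Fin n → Set} (f : Fin n → ℕ) → ∑[ i < n ] f i ≤ 2 →
                (∀ {i} → P i → 1 ≤ f i) → AtMostTwo P
∑≤2⇒AtMostTwo f ∑f≤2 1≤f {x} {y} {z} Px Py Pz with x ≟ y | x ≟ z | y ≟ z
... | yes x≡y | _       | _       = inj₁ x≡y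
... | _       | yes x≡z | _       = inj₂ (inj₁ x≡z)
... | _       | _       | yes y≡z = inj₂ (inj₂ y≡z)
... | no x≢y  | no x≢z  | no y≢z  = ⊥-elim (<-irrefl refl (begin-strict
  2                   <⟨ +-mono-≤ (1≤f Px) (+-mono-≤ (1≤f Py) (1≤f Pz)) ⟩
  f x + (f y + f z)   ≤⟨ triple-≤-∑ f x≢y x≢z y≢z ⟩
  ∑[ i < _ ] f i      ≤⟨ ∑f≤2 ⟩
  2                   ∎))
  where open ≤-Reasoning

AtMostTwo-involutive : {X : Set} {P : X → Set} {σ : X → X} → AtMostTwo P → Injective _≡_ _≡_ σ →
                       (∀ {x} → P x → P (σ x)) → ∀ {x} → P x → σ (σ x) ≡ x
AtMostTwo-involutive {σ = σ} atMostTwo σ-inj σP {x} Px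
  with atMostTwo Px (σP Px) (σP (σP Px))
... | inj₁ x≡σx          = trans (cong σ (sym x≡σx)) (sym x≡σx)
... | inj₂ (inj₁ x≡σσx)  = sym x≡σσx
... | inj₂ (inj₂ σx≡σσx) = trans (cong σ (sym x≡σx)) (sym x≡σx)
  where x≡σx = σ-inj σx≡σσx

module _ {X : Set} (f : X → X) where

  iter-+ : ∀ m n x → iter f (m + n) x ≡ iter f m (iter f n x)
  iter-+ zero    n x = refl
  iter-+ (suc m) n x = cong f (iter-+ m n x)

  iter-fix-* : ∀ {m x} → iter f m x ≡ x → ∀ q → iter f (q * m) x ≡ x
  iter-fix-* fix zero    = refl
  iter-fix-* {m} {x} fix (suc q) = trans (iter-+ m (q * m) x) (trans (cong (iter f m) (iter-fix-* fix q)) fix)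

  iter-injective : Injective _≡_ _≡_ f → ∀ m → Injective _≡_ _≡_ (iter f m)
  iter-injective f-inj zero    eq = eq
  iter-injective f-inj (suc m) eq = iter-injective f-inj m (f-inj eq)

  iter-preserves : (R : X → X → Set) → (∀ {a b} → R a b → R (f a) (f b)) →
                   ∀ m {a b} → R a b → R (iter f m a) (iter f m b)
  iter-preserves R f-pres zero    r = r
  iter-preserves R f-pres (suc m) r = f-pres (iter-preserves R f-pres m r)

  ord-∣ : ∀ {x o L} → IsOrd f x o → iter f L x ≡ x → o ∣ L
  ord-∣ {x} {o} {L} (1≤o , fix-o , minimal) fix-L = m%n≡0⇒n∣m L o L%o≡0
    where
    instance
      _ = >-nonZero 1≤o
    fix-rem : iter f (L % o) x ≡ x
    fix-rem = begin
      iter f (L % o) x                        ≡⟨ cong (iter f (L % o)) (iter-fix-* fix-o (L / o)) ⟨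
      iter f (L % o) (iter f (L / o * o) x)   ≡⟨ iter-+ (L % o) (L / o * o) x ⟨
      iter f (L % o + L / o * o) x            ≡⟨ cong (λ m → iter f m x) (m≡m%n+[m/n]*n L o) ⟨
      iter f L x                              ≡⟨ fix-L ⟩
      x                                       ∎
      where open ≡-Reasoning
    L%o≡0 : L % o ≡ 0
    L%o≡0 with L % o Data.Nat.≟ 0
    ... | yes L%o≡0 = L%o≡0
    ... | no  L%o≢0 = ⊥-elim (minimal (L % o) (n≢0⇒n>0 L%o≢0) (m%n<n L o) fix-rem)

  ord-exists : DecidableEquality X → ∀ {x} L → 1 ≤ L → iter f L x ≡ x → ∃ (IsOrd f x)
  ord-exists _≟ₓ_ {x} = <-rec _ descend
    where
    descend : ∀ L → (∀ {s} → s < L → 1 ≤ s → iter f s x ≡ x → ∃ (IsOrd f x)) →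
              1 ≤ L → iter f L x ≡ x → ∃ (IsOrd f x)
    descend L smaller 1≤L fix-L with anyUpTo? (λ s → (1 ≤? s) ×-dec (iter f s x ≟ₓ x)) L
    ... | yes (s , s<L , 1≤s , fix-s) = smaller s<L 1≤s fix-s
    ... | no  none = L , 1≤L , fix-L , λ s 1≤s s<L fix-s → none (s , s<L , 1≤s , fix-s)

  module _ (_≟ₓ_ : DecidableEquality X) {α : ℕ} (1≤α : 1 ≤ α) where

    InH⇔fixed : ∀ {x} → InH f α x ⇔ (∃[ t ] iter f (2 ^ t * α) x ≡ x)
    InH⇔fixed {x} = mk⇔ fixed fromFixed
      where
      fixed : InH f α x → ∃[ t ] iter f (2 ^ t * α) x ≡ x
      fixed (t , o , (_ , fix-o , _) , divides q eq) =
        t , subst (λ m → iter f m x ≡ x) (sym eq) (iter-fix-* fix-o q)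
      fromFixed : ∃[ t ] iter f (2 ^ t * α) x ≡ x → InH f α x
      fromFixed (t , fix) with ord-exists _≟ₓ_ (2 ^ t * α) (*-mono-≤ (m^n>0 2 t) 1≤α) fix
      ... | o , ord = t , o , ord , ord-∣ ord fix

    fixed-2^+ : ∀ {x} t s → iter f (2 ^ t * α) x ≡ x → iter f (2 ^ (s + t) * α) x ≡ x
    fixed-2^+ {x} t s fix = subst (λ m → iter f m x ≡ x) 2^s*[2^t*α]≡2^[s+t]*α (iter-fix-* fix (2 ^ s))
      where
      2^s*[2^t*α]≡2^[s+t]*α : 2 ^ s * (2 ^ t * α) ≡ 2 ^ (s + t) * α
      2^s*[2^t*α]≡2^[s+t]*α = trans (sym (*-assoc (2 ^ s) (2 ^ t) α)) (cong (_* α) (sym (^-distribˡ-+-* 2 s t)))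

    iter-2^suc : ∀ t x → iter f (2 ^ suc t * α) x ≡ iter f (2 ^ t * α) (iter f (2 ^ t * α) x)
    iter-2^suc t x = begin
      iter f (2 ^ suc t * α) x      ≡⟨ cong (λ m → iter f m x) (*-assoc 2 (2 ^ t) α) ⟩
      iter f (B + (B + 0)) x        ≡⟨ cong (λ m → iter f (B + m) x) (+-identityʳ B) ⟩
      iter f (B + B) x              ≡⟨ iter-+ B B x ⟩
      iter f B (iter f B x)         ∎
      where
      open ≡-Reasoning
      B = 2 ^ t * α

    -- For t large, f ^ (2 ^ t * α) fixes a and b, hence permutes P, so its square fixes x.
    InH-of-AtMostTwo : Injective _≡_ _≡_ f → ∀ {a b} → InH f α a → InH f α b →
                       {P : X → Set} → AtMostTwo P →
                       (∀ m → iter f m a ≡ a → iter f m b ≡ b → ∀ {y} → P y → P (iter f m y)) →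
                       ∀ {x} → P x → InH f α x
    InH-of-AtMostTwo f-inj {a} {b} Ha Hb atMostTwo invariant {x} Px =
      Equivalence.from InH⇔fixed (suc t , trans (iter-2^suc t x)
        (AtMostTwo-involutive atMostTwo (iter-injective f-inj B) (invariant B fix-a fix-b) Px))
      where
      ta = proj₁ (Equivalence.to InH⇔fixed Ha)
      tb = proj₁ (Equivalence.to InH⇔fixed Hb)
      t = tb + ta
      B = 2 ^ t * α
      fix-a : iter f B a ≡ a
      fix-a = fixed-2^+ ta tb (proj₂ (Equivalence.to InH⇔fixed Ha))
      fix-b : iter f B b ≡ b
      fix-b = subst (λ s → iter f (2 ^ s * α) b ≡ b) (+-comm ta tb) (fixed-2^+ tb ta (proj₂ (Equivalence.to InH⇔fixed Hb)))

module _ {n : ℕ} (A : Digraph n) where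

  Arc : Fin n → Fin n → Set
  Arc u w = A u w ≡ true

  walk-map : ∀ {σ : Fin n → Fin n} → (∀ {a b} → Arc a b → Arc (σ a) (σ b)) →
             ∀ {u w ℓ} → Walk A u w ℓ → Walk A (σ u) (σ w) ℓ
  walk-map σ-arc here       = here
  walk-map σ-arc (step a p) = step (σ-arc a) (walk-map σ-arc p)

  visits-suffix : ∀ {u w ℓ} (p : Walk A u w ℓ) {x} → Visits A p x → ∃[ ℓ′ ] ℓ′ ≤ ℓ × Walk A x w ℓ′
  visits-suffix here        refl        = 0 , z≤n , here
  visits-suffix (step a p)  (inj₁ refl) = _ , ≤-refl , step a p
  visits-suffix (step a p)  (inj₂ x∈p)  with visits-suffix p x∈p
  ... | ℓ′ , ℓ′≤ℓ , q = ℓ′ , m≤n⇒m≤1+n ℓ′≤ℓ , q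

  visits-split : ∀ {u w ℓ} (p : Walk A u w ℓ) {x} → Visits A p x →
                 u ≡ x ⊎ ∃[ ℓ′ ] ℓ′ < ℓ × Walk A x w ℓ′
  visits-split here       u≡x         = inj₁ u≡x
  visits-split (step a p) (inj₁ u≡x)  = inj₁ u≡x
  visits-split (step a p) (inj₂ x∈p)  with visits-suffix p x∈p
  ... | ℓ′ , ℓ′≤ℓ , q = inj₂ (ℓ′ , s≤s ℓ′≤ℓ , q)

  shortest-≤ : ∀ {k} → (∀ u w → ∃[ ℓ ] ℓ ≤ k × Walk A u w ℓ) →
               ∀ {u w ℓ} (p : Walk A u w ℓ) → Shortest A p → ℓ ≤ k
  shortest-≤ reach {u} {w} p shortest = ≮⇒≥ λ k<ℓ →
    let ℓ′ , ℓ′≤k , q = reach u w in shortest ℓ′ (≤-<-trans ℓ′≤k k<ℓ) q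

  Second : ℕ → Fin n → Fin n → Fin n → Set
  Second K u w y = Arc u y × ∃[ m ] m ≤ K × Walk A y w m

  Penultimate : ℕ → Fin n → Fin n → Fin n → Set
  Penultimate K u w y = (∃[ m ] m ≤ K × Walk A u y m) × Arc y w

  module _ {K : ℕ} {σ : Fin n → Fin n} (σ-arc : ∀ {a b} → Arc a b → Arc (σ a) (σ b))
           {u w : Fin n} (σu≡u : σ u ≡ u) (σw≡w : σ w ≡ w) where

    Second-map : ∀ {y} → Second K u w y → Second K u w (σ y)
    Second-map (a , m , m≤K , p) =
      subst (λ x → Arc x (σ _)) σu≡u (σ-arc a) ,
      m , m≤K , subst (λ x → Walk A (σ _) x m) σw≡w (walk-map σ-arc p)

    Penultimate-map : ∀ {y} → Penultimate K u w y → Penultimate K u w (σ y)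
    Penultimate-map ((m , m≤K , p) , a) =
      (m , m≤K , subst (λ x → Walk A x (σ _) m) σu≡u (walk-map σ-arc p)) ,
      subst (Arc (σ _)) σw≡w (σ-arc a)

module WalkCounting {n : ℕ} (A : Digraph n) {d : ℕ} (diregular : Diregular A d) where

  W : ℕ → Fin n → Fin n → ℕ
  W = nWalks A

  M : ℕ → Fin n → Fin n → ℕ
  M = nWalks≤ A

  W-suc : ∀ ℓ u w → W (suc ℓ) u w ≡ ∑[ x < n ] (A u x ⊙ W ℓ x w)
  W-suc ℓ u w = ∑-allFin (λ x → A u x ⊙ W ℓ x w)

  outdeg-∑ : ∀ u → ∑[ x < n ] (A u x ⊙ 1) ≡ d
  outdeg-∑ u = trans (sym (∑-allFin (λ x → A u x ⊙ 1))) (proj₁ (diregular u))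

  indeg-∑ : ∀ w → ∑[ x < n ] (A x w ⊙ 1) ≡ d
  indeg-∑ w = trans (sym (∑-allFin (λ x → A x w ⊙ 1))) (proj₂ (diregular w))

  W-suc-last : ∀ ℓ u w → W (suc ℓ) u w ≡ ∑[ x < n ] (A x w ⊙ W ℓ u x)
  W-suc-last zero u w = begin
    W 1 u w                                     ≡⟨ W-suc 0 u w ⟩
    ∑[ x < n ] (A u x ⊙ does (x ≟ w) ⊙ 1)       ≡⟨ sum-cong-≗ (λ x → ⊙-comm (A u x) _ 1) ⟩
    ∑[ x < n ] (does (x ≟ w) ⊙ A u x ⊙ 1)       ≡⟨ ∑-sift′ w (λ x → A u x ⊙ 1) ⟩
    A u w ⊙ 1                                   ≡⟨ ∑-sift u (λ x → A x w ⊙ 1) ⟨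
    ∑[ x < n ] (does (u ≟ x) ⊙ A x w ⊙ 1)       ≡⟨ sum-cong-≗ (λ x → ⊙-comm _ (A x w) 1) ⟩
    ∑[ x < n ] (A x w ⊙ W 0 u x)                ∎
    where open ≡-Reasoning
  W-suc-last (suc ℓ) u w = begin
    W (suc (suc ℓ)) u w                                  ≡⟨ W-suc (suc ℓ) u w ⟩
    ∑[ y < n ] (A u y ⊙ W (suc ℓ) y w)                   ≡⟨ sum-cong-≗ (λ y → cong (A u y ⊙_) (W-suc-last ℓ y w)) ⟩
    ∑[ y < n ] (A u y ⊙ ∑[ x < n ] (A x w ⊙ W ℓ y x))    ≡⟨ sum-cong-≗ (λ y → ∑-⊙ (A u y) (λ x → A x w ⊙ W ℓ y x)) ⟨
    ∑[ y < n ] ∑[ x < n ] (A u y ⊙ A x w ⊙ W ℓ y x)      ≡⟨ ∑-comm (λ y x → A u y ⊙ A x w ⊙ W ℓ y x) ⟩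
    ∑[ x < n ] ∑[ y < n ] (A u y ⊙ A x w ⊙ W ℓ y x)      ≡⟨ sum-cong-≗ (λ x → sum-cong-≗ (λ y → ⊙-comm (A u y) (A x w) _)) ⟩
    ∑[ x < n ] ∑[ y < n ] (A x w ⊙ A u y ⊙ W ℓ y x)      ≡⟨ sum-cong-≗ (λ x → ∑-⊙ (A x w) (λ y → A u y ⊙ W ℓ y x)) ⟩
    ∑[ x < n ] (A x w ⊙ ∑[ y < n ] (A u y ⊙ W ℓ y x))    ≡⟨ sum-cong-≗ (λ x → cong (A x w ⊙_) (W-suc ℓ u x)) ⟨
    ∑[ x < n ] (A x w ⊙ W (suc ℓ) u x)                   ∎
    where open ≡-Reasoning

  W-row : ∀ ℓ u → ∑[ w < n ] W ℓ u w ≡ d ^ ℓ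
  W-row zero    u = ∑-sift u (λ _ → 1)
  W-row (suc ℓ) u = begin
    ∑[ w < n ] W (suc ℓ) u w                           ≡⟨ sum-cong-≗ (W-suc ℓ u) ⟩
    ∑[ w < n ] ∑[ x < n ] (A u x ⊙ W ℓ x w)            ≡⟨ ∑-comm (λ w x → A u x ⊙ W ℓ x w) ⟩
    ∑[ x < n ] ∑[ w < n ] (A u x ⊙ W ℓ x w)            ≡⟨ sum-cong-≗ (λ x → ∑-⊙ (A u x) (λ w → W ℓ x w)) ⟩
    ∑[ x < n ] (A u x ⊙ ∑[ w < n ] W ℓ x w)            ≡⟨ sum-cong-≗ (λ x → cong (A u x ⊙_) (W-row ℓ x)) ⟩
    ∑[ x < n ] (A u x ⊙ d ^ ℓ)                         ≡⟨ ∑-⊙-const (A u) _ ⟩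
    ∑[ x < n ] (A u x ⊙ 1) * d ^ ℓ                     ≡⟨ cong (_* d ^ ℓ) (outdeg-∑ u) ⟩
    d * d ^ ℓ                                          ∎
    where open ≡-Reasoning

  W-col : ∀ ℓ w → ∑[ u < n ] W ℓ u w ≡ d ^ ℓ
  W-col zero    w = ∑-sift′ w (λ _ → 1)
  W-col (suc ℓ) w = begin
    ∑[ u < n ] W (suc ℓ) u w                           ≡⟨ sum-cong-≗ (λ u → W-suc-last ℓ u w) ⟩
    ∑[ u < n ] ∑[ x < n ] (A x w ⊙ W ℓ u x)            ≡⟨ ∑-comm (λ u x → A x w ⊙ W ℓ u x) ⟩
    ∑[ x < n ] ∑[ u < n ] (A x w ⊙ W ℓ u x)            ≡⟨ sum-cong-≗ (λ x → ∑-⊙ (A x w) (λ u → W ℓ u x)) ⟩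
    ∑[ x < n ] (A x w ⊙ ∑[ u < n ] W ℓ u x)            ≡⟨ sum-cong-≗ (λ x → cong (A x w ⊙_) (W-col ℓ x)) ⟩
    ∑[ x < n ] (A x w ⊙ d ^ ℓ)                         ≡⟨ ∑-⊙-const (λ x → A x w) _ ⟩
    ∑[ x < n ] (A x w ⊙ 1) * d ^ ℓ                     ≡⟨ cong (_* d ^ ℓ) (indeg-∑ w) ⟩
    d * d ^ ℓ                                          ∎
    where open ≡-Reasoning

  M-row : ∀ K u → ∑[ w < n ] M K u w ≡ suc (order d K)
  M-row zero    u = W-row 0 u
  M-row (suc K) u = trans (∑-distrib-+ (M K u) (W (suc K) u)) (cong₂ _+_ (M-row K u) (W-row (suc K) u))

  M-col : ∀ K w → ∑[ u < n ] M K u w ≡ suc (order d K)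
  M-col zero    w = W-col 0 w
  M-col (suc K) w = trans (∑-distrib-+ (λ u → M K u w) (λ u → W (suc K) u w)) (cong₂ _+_ (M-col K w) (W-col (suc K) w))

  M-suc-first : ∀ K u w → M (suc K) u w ≡ W 0 u w + ∑[ x < n ] (A u x ⊙ M K x w)
  M-suc-first zero    u w = cong (W 0 u w +_) (W-suc 0 u w)
  M-suc-first (suc K) u w = begin
    M (suc K) u w + W (suc (suc K)) u w
      ≡⟨ cong₂ _+_ (M-suc-first K u w) (W-suc (suc K) u w) ⟩
    (W 0 u w + ∑[ x < n ] (A u x ⊙ M K x w)) + ∑[ x < n ] (A u x ⊙ W (suc K) x w)
      ≡⟨ +-assoc (W 0 u w) _ _ ⟩
    W 0 u w + (∑[ x < n ] (A u x ⊙ M K x w) + ∑[ x < n ] (A u x ⊙ W (suc K) x w))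
      ≡⟨ cong (W 0 u w +_) (∑-distrib-+ (λ x → A u x ⊙ M K x w) _) ⟨
    W 0 u w + ∑[ x < n ] (A u x ⊙ M K x w + A u x ⊙ W (suc K) x w)
      ≡⟨ cong (W 0 u w +_) (sum-cong-≗ (λ x → ⊙-distribˡ-+ (A u x) _ _)) ⟨
    W 0 u w + ∑[ x < n ] (A u x ⊙ M (suc K) x w)
      ∎
    where open ≡-Reasoning

  M-suc-last : ∀ K u w → M (suc K) u w ≡ W 0 u w + ∑[ x < n ] (A x w ⊙ M K u x)
  M-suc-last zero    u w = cong (W 0 u w +_) (W-suc-last 0 u w)
  M-suc-last (suc K) u w = begin
    M (suc K) u w + W (suc (suc K)) u w
      ≡⟨ cong₂ _+_ (M-suc-last K u w) (W-suc-last (suc K) u w) ⟩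
    (W 0 u w + ∑[ x < n ] (A x w ⊙ M K u x)) + ∑[ x < n ] (A x w ⊙ W (suc K) u x)
      ≡⟨ +-assoc (W 0 u w) _ _ ⟩
    W 0 u w + (∑[ x < n ] (A x w ⊙ M K u x) + ∑[ x < n ] (A x w ⊙ W (suc K) u x))
      ≡⟨ cong (W 0 u w +_) (∑-distrib-+ (λ x → A x w ⊙ M K u x) _) ⟨
    W 0 u w + ∑[ x < n ] (A x w ⊙ M K u x + A x w ⊙ W (suc K) u x)
      ≡⟨ cong (W 0 u w +_) (sum-cong-≗ (λ x → ⊙-distribˡ-+ (A x w) _ _)) ⟨
    W 0 u w + ∑[ x < n ] (A x w ⊙ M (suc K) u x)
      ∎
    where open ≡-Reasoning

  M-mono : ∀ {K K′} → K ≤ K′ → ∀ u w → M K u w ≤ M K′ u w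
  M-mono {K′ = zero}   z≤n    u w = ≤-refl
  M-mono {K′ = suc K′} K≤1+K′ u w with m≤n⇒m<n∨m≡n K≤1+K′
  ... | inj₁ (s≤s K≤K′) = ≤-trans (M-mono K≤K′ u w) (m≤m+n _ _)
  ... | inj₂ refl       = ≤-refl

  W≤M : ∀ {ℓ K} → ℓ ≤ K → ∀ u w → W ℓ u w ≤ M K u w
  W≤M {zero}  ℓ≤K u w = M-mono ℓ≤K u w
  W≤M {suc ℓ} ℓ≤K u w = ≤-trans (m≤n+m _ _) (M-mono ℓ≤K u w)

  walk⇒1≤W : ∀ {u w ℓ} → Walk A u w ℓ → 1 ≤ W ℓ u w
  walk⇒1≤W {u} here = ≤-reflexive (sym (δ-refl u))
  walk⇒1≤W {u} {w} {suc ℓ} (step {x = x} a p) = begin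
    1                                ≤⟨ walk⇒1≤W p ⟩
    W ℓ x w                          ≡⟨ cong (_⊙ W ℓ x w) a ⟨
    A u x ⊙ W ℓ x w                  ≤⟨ ≤-∑ (λ y → A u y ⊙ W ℓ y w) x ⟩
    ∑[ y < n ] (A u y ⊙ W ℓ y w)     ≡⟨ W-suc ℓ u w ⟨
    W (suc ℓ) u w                    ∎
    where open ≤-Reasoning

  walk⇒1≤M : ∀ {u w ℓ K} → ℓ ≤ K → Walk A u w ℓ → 1 ≤ M K u w
  walk⇒1≤M ℓ≤K p = ≤-trans (walk⇒1≤W p) (W≤M ℓ≤K _ _)

  two-walks⇒2≤M : ∀ {u w ℓ ℓ′ K} → ℓ < ℓ′ → ℓ′ ≤ K → Walk A u w ℓ → Walk A u w ℓ′ → 2 ≤ M K u w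
  two-walks⇒2≤M {u} {w} {ℓ} {suc ℓ′} {K} (s≤s ℓ≤ℓ′) ℓ′<K p q = begin
    2                                 ≤⟨ +-mono-≤ (walk⇒1≤W p) (walk⇒1≤W q) ⟩
    W ℓ u w + W (suc ℓ′) u w          ≤⟨ +-monoˡ-≤ _ (W≤M ℓ≤ℓ′ u w) ⟩
    M ℓ′ u w + W (suc ℓ′) u w         ≤⟨ M-mono ℓ′<K u w ⟩
    M K u w                           ∎
    where open ≤-Reasoning

module RepeatStructure {d k : ℕ} (A : Digraph (order d k)) (diregular : Diregular A d)
         (reach : ∀ u w → ∃[ ℓ ] ℓ ≤ k × Walk A u w ℓ)
         (r : Fin (order d k) → Fin (order d k)) (repeat : IsRepeat A k r) where

  open WalkCounting A diregular

  N : ℕ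
  N = order d k

  1≤M : ∀ u w → 1 ≤ M k u w
  1≤M u w = let ℓ , ℓ≤k , p = reach u w in walk⇒1≤M ℓ≤k p

  M≤2 : ∀ u w → M k u w ≤ 2
  M≤2 u w = ∑-excess (M k u) (1≤M u) (trans (M-row k u) (+-comm 1 N)) w

  2≤M⇒repeat : ∀ {u w} → 2 ≤ M k u w → r u ≡ w
  2≤M⇒repeat {u} {w} 2≤M = sym (proj₁ (repeat u w) (≤-antisym (M≤2 u w) 2≤M))

  M≡1+δ : ∀ u w → M k u w ≡ suc (δ (r u) w)
  M≡1+δ u w with r u ≟ w
  ... | yes ru≡w = proj₂ (repeat u w) (sym ru≡w)
  ... | no  ru≢w = ≤-antisym (≤-pred (≤∧≢⇒< (M≤2 u w) (ru≢w ∘ 2≤M⇒repeat ∘ ≤-reflexive ∘ sym))) (1≤M u w)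

  ∑-δ-repeat : ∀ w → ∑[ u < N ] δ (r u) w ≡ 1
  ∑-δ-repeat w = +-cancelˡ-≡ N _ _ (begin
    N + ∑[ u < N ] δ (r u) w       ≡⟨ ∑-suc (λ u → δ (r u) w) ⟨
    ∑[ u < N ] suc (δ (r u) w)     ≡⟨ sum-cong-≗ (λ u → M≡1+δ u w) ⟨
    ∑[ u < N ] M k u w             ≡⟨ M-col k w ⟩
    suc N                          ≡⟨ +-comm 1 N ⟩
    N + 1                          ∎)
    where open ≡-Reasoning

  r-injective : Injective _≡_ _≡_ r
  r-injective {a} {b} ra≡rb with a ≟ b
  ... | yes a≡b = a≡b
  ... | no  a≢b = ⊥-elim (<-irrefl refl (begin-strict
    1                                 <⟨ ≤-refl ⟩
    2                                 ≡⟨ cong₂ _+_ (δ-refl (r a)) (trans (cong (λ x → δ x (r a)) (sym ra≡rb)) (δ-refl (r a))) ⟨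
    δ (r a) (r a) + δ (r b) (r a)     ≤⟨ pair-≤-∑ (λ u → δ (r u) (r a)) a≢b ⟩
    ∑[ u < N ] δ (r u) (r a)          ≡⟨ ∑-δ-repeat (r a) ⟩
    1                                 ∎))
    where open ≤-Reasoning

  -- Both sides count the walks u → w of length between 1 and k + 1.
  ∑-out-M≡∑-in-M : ∀ u w → ∑[ x < N ] (A u x ⊙ M k x w) ≡ ∑[ x < N ] (A x w ⊙ M k u x)
  ∑-out-M≡∑-in-M u w = +-cancelˡ-≡ (W 0 u w) _ _ (trans (sym (M-suc-first k u w)) (M-suc-last k u w))

  ∑-out-δ-repeat : ∀ u w → ∑[ x < N ] (A u x ⊙ δ (r x) w) ≡ A (r u) w ⊙ 1
  ∑-out-δ-repeat u w = +-cancelˡ-≡ d _ _ (begin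
    d + ∑[ x < N ] (A u x ⊙ δ (r x) w)                          ≡⟨ cong (_+ ∑[ x < N ] (A u x ⊙ δ (r x) w)) (outdeg-∑ u) ⟨
    ∑[ x < N ] (A u x ⊙ 1) + ∑[ x < N ] (A u x ⊙ δ (r x) w)     ≡⟨ ∑-⊙-suc (A u) (λ x → δ (r x) w) ⟨
    ∑[ x < N ] (A u x ⊙ suc (δ (r x) w))                        ≡⟨ sum-cong-≗ (λ x → cong (A u x ⊙_) (M≡1+δ x w)) ⟨
    ∑[ x < N ] (A u x ⊙ M k x w)                                ≡⟨ ∑-out-M≡∑-in-M u w ⟩
    ∑[ x < N ] (A x w ⊙ M k u x)                                ≡⟨ sum-cong-≗ (λ x → cong (A x w ⊙_) (M≡1+δ u x)) ⟩
    ∑[ x < N ] (A x w ⊙ suc (δ (r u) x))                        ≡⟨ ∑-⊙-suc (λ x → A x w) (δ (r u)) ⟩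
    ∑[ x < N ] (A x w ⊙ 1) + ∑[ x < N ] (A x w ⊙ δ (r u) x)     ≡⟨ cong₂ _+_ (indeg-∑ w) (sum-cong-≗ (λ x → ⊙-comm (A x w) _ 1)) ⟩
    d + ∑[ x < N ] (does (r u ≟ x) ⊙ A x w ⊙ 1)                 ≡⟨ cong (d +_) (∑-sift (r u) (λ x → A x w ⊙ 1)) ⟩
    d + A (r u) w ⊙ 1                                           ∎)
    where open ≡-Reasoning

  r-preserves-arcs : ∀ {u x} → Arc A u x → Arc A (r u) (r x)
  r-preserves-arcs {u} {x} u→x = 1≤⊙⇒true (begin
    1                                      ≡⟨ δ-refl (r x) ⟨
    δ (r x) (r x)                          ≡⟨ cong (_⊙ δ (r x) (r x)) u→x ⟨
    A u x ⊙ δ (r x) (r x)                  ≤⟨ ≤-∑ (λ y → A u y ⊙ δ (r y) (r x)) x ⟩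
    ∑[ y < N ] (A u y ⊙ δ (r y) (r x))     ≡⟨ ∑-out-δ-repeat u (r x) ⟩
    A (r u) (r x) ⊙ 1                      ∎)
    where open ≤-Reasoning

  iter-r-preserves-arcs : ∀ m {u x} → Arc A u x → Arc A (iter r m u) (iter r m x)
  iter-r-preserves-arcs = iter-preserves r (Arc A) r-preserves-arcs

  -- The walks z → v of lengths 1 and 2 make r z = v; those v → v of lengths 0 and 1 make r v = v.
  in-neighbour-of-loop : 2 ≤ k → ∀ {v z} → Arc A v v → Arc A z v → z ≡ v
  in-neighbour-of-loop 2≤k {v} {z} v→v z→v = r-injective (trans rz≡v (sym rv≡v))
    where
    rz≡v : r z ≡ v
    rz≡v = 2≤M⇒repeat (two-walks⇒2≤M ≤-refl 2≤k (step z→v here) (step z→v (step v→v here)))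
    rv≡v : r v ≡ v
    rv≡v = 2≤M⇒repeat (two-walks⇒2≤M ≤-refl (<⇒≤ 2≤k) here (step v→v here))

  Second-AtMostTwo : ∀ {K} → K < k → ∀ u w → AtMostTwo (Second A K u w)
  Second-AtMostTwo {K} K<k u w = ∑≤2⇒AtMostTwo (λ y → A u y ⊙ M K y w) ∑≤2
    λ (u→y , m , m≤K , p) → subst (λ b → 1 ≤ b ⊙ M K _ w) (sym u→y) (walk⇒1≤M m≤K p)
    where
    ∑≤2 : ∑[ y < N ] (A u y ⊙ M K y w) ≤ 2
    ∑≤2 = begin
      ∑[ y < N ] (A u y ⊙ M K y w)              ≤⟨ m≤n+m _ (W 0 u w) ⟩
      W 0 u w + ∑[ y < N ] (A u y ⊙ M K y w)    ≡⟨ M-suc-first K u w ⟨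
      M (suc K) u w                             ≤⟨ M-mono K<k u w ⟩
      M k u w                                   ≤⟨ M≤2 u w ⟩
      2                                         ∎
      where open ≤-Reasoning

  Penultimate-AtMostTwo : ∀ {K} → K < k → ∀ u w → AtMostTwo (Penultimate A K u w)
  Penultimate-AtMostTwo {K} K<k u w = ∑≤2⇒AtMostTwo (λ y → A y w ⊙ M K u y) ∑≤2
    λ ((m , m≤K , p) , y→w) → subst (λ b → 1 ≤ b ⊙ M K u _) (sym y→w) (walk⇒1≤M m≤K p)
    where
    ∑≤2 : ∑[ y < N ] (A y w ⊙ M K u y) ≤ 2
    ∑≤2 = begin
      ∑[ y < N ] (A y w ⊙ M K u y)              ≤⟨ m≤n+m _ (W 0 u w) ⟩
      W 0 u w + ∑[ y < N ] (A y w ⊙ M K u y)    ≡⟨ M-suc-last K u w ⟨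
      M (suc K) u w                             ≤⟨ M-mono K<k u w ⟩
      M k u w                                   ≤⟨ M≤2 u w ⟩
      2                                         ∎
      where open ≤-Reasoning

corollary1 : (d k : ℕ) (A : Digraph (order d k)) → IsDKDigraph d k A →
    (r : Fin (order d k) → Fin (order d k)) → IsRepeat A k r →
    (α : ℕ) → 1 < α →
    (v : Fin (order d k)) → InH r α v →
    (vj : Fin (order d k)) → A v vj ≡ true →
    (z : Fin (order d k)) → A z v ≡ true → InT A v vj z →
    (InH r α vj ⇔ InH r α z)
corollary1 d k A (_ , 1<k , diregular , (reach , _)) r repeat α 1<α v Hv vj v→vj z z→v (ℓ , p , shortest , vj∈p)
  with visits-split A p vj∈p
... | inj₁ v≡vj = mk⇔ (λ _ → subst (InH r α) (sym z≡v) Hv) (λ _ → subst (InH r α) v≡vj Hv)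
  where
  open RepeatStructure A diregular reach r repeat
  z≡v : z ≡ v
  z≡v = in-neighbour-of-loop 1<k (subst (Arc A v) (sym v≡vj) v→vj) z→v
... | inj₂ (ℓ′ , ℓ′<ℓ , vj⇝z) = mk⇔
  (λ Hvj → InH-of-AtMostTwo r _≟_ 1≤α r-injective Hvj Hv (Penultimate-AtMostTwo ℓ′<k vj v)
             (λ m → Penultimate-map A (iter-r-preserves-arcs m)) ((ℓ′ , ≤-refl , vj⇝z) , z→v))
  (λ Hz → InH-of-AtMostTwo r _≟_ 1≤α r-injective Hv Hz (Second-AtMostTwo ℓ′<k v z)
             (λ m → Second-map A (iter-r-preserves-arcs m)) (v→vj , ℓ′ , ≤-refl , vj⇝z))
  where
  open RepeatStructure A diregular reach r repeat
  1≤α : 1 ≤ α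
  1≤α = <⇒≤ 1<α
  ℓ′<k : ℓ′ < k
  ℓ′<k = ≤-trans ℓ′<ℓ (shortest-≤ A reach p shortest)
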